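{- With the notation of the context, let $\alpha,\beta\in\mathbb{F}_q$. Then: (i) For $l\in\{0,3\}$, $A_{\alpha,0}A_{\beta,l}= A_{\alpha+\beta,l}$, and for $l\in\{1,2\}$, $A_{\alpha,0}A_{\beta,l}= A_{\beta,l}$. (ii) $A_{\alpha,1}A_{\beta,1}=A_{\alpha,2}A_{\beta,2}=q A_{\alpha+\beta,1}$ and $A_{\alpha,1}A_{\beta,2}=q A_{\alpha+\beta,2}$. (iii) $A_{\alpha,1}A_{\beta,3}=A_{\alpha,2}A_{\beta,3}=\sum_{\gamma\in\mathbb{F}_q}A_{\gamma,3}$ and $$A_{\alpha,3}A_{\beta,3}=q^2A_{\alpha+\beta,0}+\sum_{\gamma\in\mathbb{F}_q}\bigl(q(-A_{\gamma,0}+A_{\gamma,1}+A_{\gamma,2})+(q-2)A_{\gamma,3}\bigr).$$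
   Context: Let $m\ge1$, $q=2^m$, $\mathbb{F}_q$ the field with $q$ elements. Fix an $\mathbb{F}_2$-linear identification of $(\mathbb{F}_q,+)$ with $\mathbb{F}_2^m$. All matrices are indexed by finite sets; for $A$ indexed by $X$ and $B$ by $Y$, $A\otimes B$ is indexed by $X\times Y$ with $((u,v),(u',v'))$-entry $A_{u,u'}B_{v,v'}$. $I_q,J_q$ (identity, all-ones) are indexed by $\mathbb{F}_q$; $O_{q^2}$ (zero) by $\mathbb{F}_q\times\mathbb{F}_q$. For $\alpha\in\mathbb{F}_q$, $\phi(\alpha)$ is the permutation matrix indexed by $\mathbb{F}_q$ with $(\gamma,\gamma')$-entry $1$ iff $\gamma+\gamma'=\alpha$ (equivalently $\otimes_{i=1}^m R^{\alpha_i}$, $R=J_2-I_2$). For $\alpha,\alpha'\in\mathbb{F}_q$, $C_{\alpha,\alpha'}$ is the matrix indexed by $\mathbb{F}_q\times\mathbb{F}_q$ with $((\beta,\gamma),(\beta',\gamma'))$-entry equal to the $(\gamma,\gamma')$-entry of $\phi(\alpha(-\beta+\beta')+\alpha')$. For new symbols $x,y$: $C_{x,\alpha}=O_{q^2}$, $C_{y,\alpha}=\phi(\alpha)\otimes J_q$. Let $S=\mathbb{F}_q\cup\{x,y\}$ and $L$ a symmetric Latin square with rows, columns and symbols indexed by $S$ and $L(a,a)=x$ for all $a$. For $a\in S$, $P_a$ is the matrix indexed by $S$ with $(b,b')$-entry $1$ iff $L(b,b')=a$; $I_{q+2}$ is indexed by $S$ and $I_{q(q+2)}$ by $S\times\mathbb{F}_q$.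 For $\alpha\in\mathbb{F}_q$, $N_\alpha=\sum_{a\in\mathbb{F}_q\cup\{y\}}P_a\otimes C_{a,\alpha}$. For every $\alpha\in\mathbb{F}_q$ define $A_{\alpha,0}=I_{q(q+2)}\otimes\phi(\alpha)$, $A_{\alpha,1}=I_{q+2}\otimes C_{y,\alpha}$, $A_{\alpha,2}=P_y\otimes C_{y,\alpha}$, $A_{\alpha,3}=N_\alpha-P_y\otimes C_{y,\alpha}$ (including $A_{0,1}$, which equals $\sum_{\gamma\in\mathbb{F}_q}A_{\gamma,0}$). -}

module Defs where

open import Level using (0ℓ)
open import Data.Nat using (ℕ; _^_)
open import Data.Integer using (ℤ; +_; 0ℤ; 1ℤ) renaming (_+_ to _+ℤ_; _*_ to _*ℤ_; -_ to -ℤ_)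
open import Data.Product using (_×_; _,_; Σ)
open import Data.List using (List; []; _∷_; _++_; map; foldr; length; cartesianProduct)
open import Data.List.Membership.Propositional using (_∈_)
open import Data.List.Relation.Unary.Unique.Propositional using (Unique)
open import Relation.Binary.PropositionalEquality using (_≡_; refl; cong)
open import Relation.Binary.Definitions using (DecidableEquality)
open import Relation.Nullary using (¬_; yes; no)
open import Algebra.Structures using (IsCommutativeRing)

-- A finite field with exactly 2^m elements (any such field is F_q, q = 2^m;
-- the statement is invariant under field isomorphism).

record FiniteField (m : ℕ) : Set₁ where
  field
    F       : Set
    _+_ _*_ : F → F → F
    -_      : F → F
    0F 1F   : F
    isCommutativeRing : IsCommutativeRing _≡_ _+_ _*_ -_ 0F 1F
    0≢1     : ¬ (0F ≡ 1F)
    inverse : ∀ a → ¬ (a ≡ 0F) → Σ F (λ b → a * b ≡ 1F)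
    _≟_     : DecidableEquality F
    elems          : List F
    elems-complete : ∀ a → a ∈ elems
    elems-unique   : Unique elems
    elems-length   : length elems ≡ 2 ^ m

Mat : Set → Set
Mat X = X → X → ℤ

δ : {X : Set} → DecidableEquality X → Mat X
δ _≟_ u v with u ≟ v
... | yes _ = 1ℤ
... | no  _ = 0ℤ

Σl : {X : Set} → List X → (X → ℤ) → ℤ
Σl xs f = foldr (λ x acc → f x +ℤ acc) 0ℤ xs

mul : {X : Set} → List X → Mat X → Mat X → Mat X
mul xs A B u w = Σl xs (λ v → A u v *ℤ B v w)

infixl 6 _⊕_
_⊕_ : {X : Set} → Mat X → Mat X → Mat X
(A ⊕ B) u v = A u v +ℤ B u v

⊖_ : {X : Set} → Mat X → Mat X
(⊖ A) u v = -ℤ (A u v)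

infixr 7 _·_
_·_ : {X : Set} → ℤ → Mat X → Mat X
(c · A) u v = c *ℤ A u v

zeroM : {X : Set} → Mat X
zeroM _ _ = 0ℤ

ΣM : {X I : Set} → List I → (I → Mat X) → Mat X
ΣM is f = foldr (λ i acc → f i ⊕ acc) zeroM is

_⊗_ : {X Y : Set} → Mat X → Mat Y → Mat (X × Y)
(A ⊗ B) (u , v) (u' , v') = A u u' *ℤ B v v'

reassoc : {X Y Z : Set} → Mat ((X × Y) × Z) → Mat (X × (Y × Z))
reassoc M (a , (b , c)) (a' , (b' , c')) = M ((a , b) , c) ((a' , b') , c')

_≋_ : {X : Set} → Mat X → Mat X → Set
A ≋ B = ∀ u v → A u v ≡ B u v

data Sym (F : Set) : Set where
  el : F → Sym F
  xS : Sym F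
  yS : Sym F

module _ {F : Set} (_≟_ : DecidableEquality F) where
  _≟S_ : DecidableEquality (Sym F)
  el a ≟S el b with a ≟ b
  ... | yes refl = yes refl
  ... | no  p    = no (λ { refl → p refl })
  el _ ≟S xS = no (λ ())
  el _ ≟S yS = no (λ ())
  xS ≟S el _ = no (λ ())
  xS ≟S xS = yes refl
  xS ≟S yS = no (λ ())
  yS ≟S el _ = no (λ ())
  yS ≟S xS = no (λ ())
  yS ≟S yS = yes refl

record IsSymLatinDiagX {F : Set} (L : Sym F → Sym F → Sym F) : Set where
  field
    row-unique : ∀ a c → Σ (Sym F) (λ b → L a b ≡ c × (∀ b' → L a b' ≡ c → b' ≡ b))
    col-unique : ∀ a c → Σ (Sym F) (λ b → L b a ≡ c × (∀ b' → L b' a ≡ c → b' ≡ b))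
    symmetric  : ∀ a b → L a b ≡ L b a
    diagonal   : ∀ a → L a a ≡ xS

module Construction {m : ℕ} (𝔽 : FiniteField m) (L : Sym (FiniteField.F 𝔽) → Sym (FiniteField.F 𝔽) → Sym (FiniteField.F 𝔽)) where
  open FiniteField 𝔽

  q : ℤ
  q = + (2 ^ m)

  S : Set
  S = Sym F

  elemsS : List S
  elemsS = map el elems ++ (xS ∷ yS ∷ [])

  Ix : Set
  Ix = S × (F × F)

  elemsIx : List Ix
  elemsIx = cartesianProduct elemsS (cartesianProduct elems elems)

  _∙_ : Mat Ix → Mat Ix → Mat Ix
  A ∙ B = mul elemsIx A B

  I-F : Mat F
  I-F = δ _≟_

  J-F : Mat F
  J-F _ _ = 1ℤ

  I-S : Mat S
  I-S = δ (_≟S_ _≟_)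

  I-SF : Mat (S × F)
  I-SF (s , b) (s' , b') = I-S s s' *ℤ I-F b b'

  φ : F → Mat F
  φ α γ γ' with (γ + γ') ≟ α
  ... | yes _ = 1ℤ
  ... | no  _ = 0ℤ

  C : F → F → Mat (F × F)
  C α α' (β , γ) (β' , γ') = φ ((α * ((- β) + β')) + α') γ γ'

  CS : S → F → Mat (F × F)
  CS (el a) α' = C a α'
  CS xS     α' = zeroM
  CS yS     α' = φ α' ⊗ J-F

  P : S → Mat S
  P a b b' with L b b' ≟S' a
    where _≟S'_ = _≟S_ _≟_
  ... | yes _ = 1ℤ
  ... | no  _ = 0ℤ

  N : F → Mat Ix
  N α = ΣM (map el elems ++ (yS ∷ [])) (λ a → P a ⊗ CS a α)

  A0 A1 A2 A3 : F → Mat Ix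
  A0 α = reassoc (I-SF ⊗ φ α)
  A1 α = I-S ⊗ CS yS α
  A2 α = P yS ⊗ CS yS α
  A3 α = N α ⊕ (⊖ (P yS ⊗ CS yS α))

  ΣF : (F → Mat Ix) → Mat Ix
  ΣF = ΣM elems

-- Because |𝔽| = 2^m is even, negation on 𝔽 cannot fix 0 alone, so 𝔽 has characteristic two;
-- then x = y is the equation x + y = 0, and every entry is the indicator of a linear equation
-- over 𝔽.  Left multiplication by A_{α,0} translates the last coordinate by α, and by A_{α,1}
-- or A_{α,2} sums the right factor over the last coordinate in block row s, resp. in the row t
-- with L(s,t) = y.  The ((s,(b,c)),(s',(b',c'))) entry of A_{α,3} is [c + c' = a(b + b') + α]
-- if L(s,s') = a ∈ 𝔽 and 0 otherwise.  In A_{α,3} A_{β,3} a middle block t with labels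
-- a = L(s,t), a' = L(t,s') in 𝔽 contributes #{d : (a + a') d = const}, which is 1 for a ≠ a'
-- and q or 0 for a = a'.  For s ≠ s' the Latin property rules out a = a', and q − 2 or q
-- columns t have both labels in 𝔽; for s = s' a row of L permutes S, so the sum runs over the
-- diagonal a = a'.
module Submission where

open import Defs
open import Data.Nat using (ℕ; _≤_)
open import Data.Product using (_×_)
open import Data.Product using (_,_)
open import Data.Integer using (+_)
open import Data.Integer using () renaming (_-_ to _-ℤ_; _*_ to _*ℤ_)

module IntegerSums where
  open import Data.Integer using (ℤ; 0ℤ; 1ℤ; -[1+_]; _+_; _*_; -_)
  import Data.Integer.Properties as ℤP
  import Data.Nat.Properties as ℕP
  open import Data.Integer.Tactic.RingSolver using (solve-∀)
  open import Data.List using (List; []; _∷_; _++_; map; length; cartesianProduct)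
  open import Data.List.Membership.Propositional using (_∈_)
  open import Data.List.Relation.Unary.Any using (here; there)
  open import Data.List.Relation.Unary.All as All using ([]; _∷_)
  open import Data.List.Relation.Unary.AllPairs using (_∷_)
  open import Data.List.Relation.Unary.Unique.Propositional using (Unique)
  open import Data.Product using (Σ; ∃; _,_)
  open import Function using (_∘_)
  open import Relation.Binary.PropositionalEquality
  open import Relation.Binary.Definitions using (DecidableEquality)
  open import Relation.Nullary using (¬_; Dec; yes; no)
  open import Data.Empty using (⊥-elim)

  𝟙 : {P : Set} → Dec P → ℤ
  𝟙 (yes _) = 1ℤ
  𝟙 (no _)  = 0ℤ

  𝟙-yes : {P : Set} (d : Dec P) → P → 𝟙 d ≡ 1ℤ
  𝟙-yes (yes _) _ = refl
  𝟙-yes (no ¬p) p = ⊥-elim (¬p p)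

  𝟙-no : {P : Set} (d : Dec P) → ¬ P → 𝟙 d ≡ 0ℤ
  𝟙-no (yes p) ¬p = ⊥-elim (¬p p)
  𝟙-no (no _)  _  = refl

  𝟙-cong : {P Q : Set} (d : Dec P) (e : Dec Q) → (P → Q) → (Q → P) → 𝟙 d ≡ 𝟙 e
  𝟙-cong (yes p) e f g = sym (𝟙-yes e (f p))
  𝟙-cong (no ¬p) e f g = sym (𝟙-no e (¬p ∘ g))

  δ≡𝟙 : {X : Set} (_≟_ : DecidableEquality X) (u v : X) → δ _≟_ u v ≡ 𝟙 (u ≟ v)
  δ≡𝟙 _≟_ u v with u ≟ v
  ... | yes _ = refl
  ... | no _  = refl

  *-zeroˡ′ : ∀ {a} b → a ≡ 0ℤ → a * b ≡ 0ℤ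
  *-zeroˡ′ b refl = refl

  *-zeroʳ′ : ∀ a {b} → b ≡ 0ℤ → a * b ≡ 0ℤ
  *-zeroʳ′ a refl = ℤP.*-zeroʳ a

  *-identityˡ′ : ∀ {a} b → a ≡ 1ℤ → a * b ≡ b
  *-identityˡ′ b refl = ℤP.*-identityˡ b

  +2*x≢1 : ∀ x → ¬ (+ 2 * x ≡ 1ℤ)
  +2*x≢1 (+ n)    eq = ℕP.even≢odd n 0 (ℤP.+-injective (trans (ℤP.pos-* 2 n) eq))
  +2*x≢1 -[1+ n ] ()

  module _ {X : Set} where
    Σl-cong : (xs : List X) {f g : X → ℤ} → (∀ x → f x ≡ g x) → Σl xs f ≡ Σl xs g
    Σl-cong []       f≗g = refl
    Σl-cong (x ∷ xs) f≗g = cong₂ _+_ (f≗g x) (Σl-cong xs f≗g)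

    Σl-zero : (xs : List X) {f : X → ℤ} → (∀ x → f x ≡ 0ℤ) → Σl xs f ≡ 0ℤ
    Σl-zero []       f≗0 = refl
    Σl-zero (x ∷ xs) f≗0 = cong₂ _+_ (f≗0 x) (Σl-zero xs f≗0)

    Σl-+ : (xs : List X) (f g : X → ℤ) → Σl xs (λ x → f x + g x) ≡ Σl xs f + Σl xs g
    Σl-+ []       f g = refl
    Σl-+ (x ∷ xs) f g = trans (cong (_+_ (f x + g x)) (Σl-+ xs f g)) (interchange (f x) (g x) _ _)
      where
      interchange : ∀ a b c d → (a + b) + (c + d) ≡ (a + c) + (b + d)
      interchange = solve-∀

    Σl-* : (xs : List X) (k : ℤ) (f : X → ℤ) → Σl xs (λ x → k * f x) ≡ k * Σl xs f
    Σl-* []       k f = sym (ℤP.*-zeroʳ k)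
    Σl-* (x ∷ xs) k f = trans (cong (_+_ (k * f x)) (Σl-* xs k f)) (sym (ℤP.*-distribˡ-+ k (f x) _))

    Σl-neg : (xs : List X) (f : X → ℤ) → Σl xs (λ x → - f x) ≡ - Σl xs f
    Σl-neg []       f = refl
    Σl-neg (x ∷ xs) f = trans (cong (_+_ (- f x)) (Σl-neg xs f)) (sym (ℤP.neg-distrib-+ (f x) _))

    Σl-++ : (xs ys : List X) (f : X → ℤ) → Σl (xs ++ ys) f ≡ Σl xs f + Σl ys f
    Σl-++ []       ys f = sym (ℤP.+-identityˡ _)
    Σl-++ (x ∷ xs) ys f = trans (cong (_+_ (f x)) (Σl-++ xs ys f)) (sym (ℤP.+-assoc (f x) _ _))

    Σl-const : (xs : List X) (k : ℤ) → Σl xs (λ _ → k) ≡ + length xs * k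
    Σl-const []       k = sym (ℤP.*-zeroˡ k)
    Σl-const (x ∷ xs) k = trans (cong (_+_ k) (Σl-const xs k)) (sym (ℤP.suc-* (+ length xs) k))

    Σl-single : {xs : List X} → Unique xs → {f : X → ℤ} {c : X} → c ∈ xs →
                (∀ x → ¬ x ≡ c → f x ≡ 0ℤ) → Σl xs f ≡ f c
    Σl-single (x∉xs ∷ _) {f} (here refl) f≗0 =
      trans (cong (_+_ (f _)) (Σl-zero′ x∉xs)) (ℤP.+-identityʳ _)
      where
      Σl-zero′ : ∀ {ys} → All.All (λ y → ¬ _ ≡ y) ys → Σl ys f ≡ 0ℤ
      Σl-zero′ []           = refl
      Σl-zero′ (x≢y ∷ x≢ys) = cong₂ _+_ (f≗0 _ (x≢y ∘ sym)) (Σl-zero′ x≢ys)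
    Σl-single {x ∷ _} (x∉xs ∷ uniq) (there c∈xs) f≗0 =
      trans (cong₂ _+_ (f≗0 x (λ x≡c → All.lookup x∉xs c∈xs x≡c)) (Σl-single uniq c∈xs f≗0))
            (ℤP.+-identityˡ _)

  Σl-map : {A B : Set} (xs : List A) (g : A → B) (f : B → ℤ) → Σl (map g xs) f ≡ Σl xs (f ∘ g)
  Σl-map []       g f = refl
  Σl-map (x ∷ xs) g f = cong (_+_ (f (g x))) (Σl-map xs g f)

  module _ {X Y : Set} where
    Σl-cartesianProduct : (xs : List X) (ys : List Y) (f : X × Y → ℤ) →
      Σl (cartesianProduct xs ys) f ≡ Σl xs (λ x → Σl ys (λ y → f (x , y)))
    Σl-cartesianProduct []       ys f = refl
    Σl-cartesianProduct (x ∷ xs) ys f = trans (Σl-++ (map (x ,_) ys) _ f)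
      (cong₂ _+_ (Σl-map ys (x ,_) f) (Σl-cartesianProduct xs ys f))

    Σl-swap : (xs : List X) (ys : List Y) (f : X → Y → ℤ) →
              Σl xs (λ x → Σl ys (f x)) ≡ Σl ys (λ y → Σl xs (λ x → f x y))
    Σl-swap []       ys f = sym (Σl-zero ys (λ _ → refl))
    Σl-swap (x ∷ xs) ys f = trans (cong (_+_ (Σl ys (f x))) (Σl-swap xs ys f))
                                  (sym (Σl-+ ys (f x) (λ y → Σl xs (λ x' → f x' y))))

    ΣM-apply : (is : List Y) (g : Y → Mat X) (u v : X) → ΣM is g u v ≡ Σl is (λ i → g i u v)
    ΣM-apply []       g u v = refl
    ΣM-apply (i ∷ is) g u v = cong (_+_ (g i u v)) (ΣM-apply is g u v)

  module _ {X : Set} (_≟_ : DecidableEquality X) {xs : List X} (uniq : Unique xs)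
           (complete : ∀ x → x ∈ xs) where
    Σl-reindex : (g : X → X) → (∀ z → Σ X (λ t → g t ≡ z × (∀ t' → g t' ≡ z → t' ≡ t))) →
                 (G : X → ℤ) → Σl xs (G ∘ g) ≡ Σl xs G
    Σl-reindex g g-bij G = begin
      Σl xs (G ∘ g)                                  ≡⟨ Σl-cong xs (sym ∘ expand) ⟩
      Σl xs (λ t → Σl xs (λ z → 𝟙 (g t ≟ z) * G z))  ≡⟨ Σl-swap xs xs (λ t z → 𝟙 (g t ≟ z) * G z) ⟩
      Σl xs (λ z → Σl xs (λ t → 𝟙 (g t ≟ z) * G z))  ≡⟨ Σl-cong xs collapse ⟩
      Σl xs G                                        ∎
      where
      open ≡-Reasoning
      expand : ∀ t → Σl xs (λ z → 𝟙 (g t ≟ z) * G z) ≡ G (g t)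
      expand t = trans (Σl-single uniq (complete (g t)) (λ z z≢gt → *-zeroˡ′ (G z) (𝟙-no (g t ≟ z) (z≢gt ∘ sym))))
                       (*-identityˡ′ (G (g t)) (𝟙-yes (g t ≟ g t) refl))
      collapse : ∀ z → Σl xs (λ t → 𝟙 (g t ≟ z) * G z) ≡ G z
      collapse z with g-bij z
      ... | t , gt≡z , unique =
        trans (Σl-single uniq (complete t) (λ t' t'≢t → *-zeroˡ′ (G z) (𝟙-no (g t' ≟ z) (t'≢t ∘ unique t'))))
              (*-identityˡ′ (G z) (𝟙-yes (g t ≟ z) gt≡z))

  -- The off-diagonal part of a symmetric matrix is counted twice.
  Σ²-symmetric-even : {X : Set} (R : X → X → ℤ) → (∀ x y → R x y ≡ R y x) → (∀ x → R x x ≡ 0ℤ) →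
                      ∀ xs → ∃ λ k → Σl xs (λ x → Σl xs (R x)) ≡ + 2 * k
  Σ²-symmetric-even R R-sym R-diag []       = 0ℤ , refl
  Σ²-symmetric-even R R-sym R-diag (z ∷ zs) with Σ²-symmetric-even R R-sym R-diag zs
  ... | k , eq = Σl zs (R z) + k , (begin
      (R z z + Σl zs (R z)) + Σl zs (λ x → R x z + Σl zs (R x))
        ≡⟨ cong₂ _+_ (cong (_+ Σl zs (R z)) (R-diag z)) (Σl-+ zs (λ x → R x z) (λ x → Σl zs (R x))) ⟩
      (0ℤ + Σl zs (R z)) + (Σl zs (λ x → R x z) + Σl zs (λ x → Σl zs (R x)))
        ≡⟨ cong₂ (λ a b → (0ℤ + Σl zs (R z)) + (a + b)) (Σl-cong zs (λ x → R-sym x z)) eq ⟩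
      (0ℤ + Σl zs (R z)) + (Σl zs (R z) + + 2 * k)
        ≡⟨ double (Σl zs (R z)) k ⟩
      + 2 * (Σl zs (R z) + k) ∎)
    where
    open ≡-Reasoning
    double : ∀ a b → (0ℤ + a) + (a + + 2 * b) ≡ + 2 * (a + b)
    double = solve-∀

module FieldArithmetic {m : ℕ} (𝔽 : FiniteField m) where
  open import Level using (0ℓ)
  open import Data.Nat using (_^_)
  open import Data.Integer using (ℤ; 0ℤ; 1ℤ; _*_)
  open import Data.Maybe using (nothing)
  open import Data.Product using (Σ; _,_)
  open import Function using (_∘_)
  open import Algebra.Bundles using (CommutativeRing)
  import Algebra.Properties.Group as GroupProperties
  open import Tactic.RingSolver.Core.AlmostCommutativeRing using (AlmostCommutativeRing; fromCommutativeRing)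
  open import Relation.Binary.PropositionalEquality
  open import Relation.Nullary using (¬_; Dec)
  open IntegerSums
  open FiniteField 𝔽 using (F; 0F; 1F; isCommutativeRing; inverse; elems; elems-unique; elems-complete; elems-length)

  commutativeRing : CommutativeRing 0ℓ 0ℓ
  commutativeRing = record { isCommutativeRing = isCommutativeRing }

  module FR = CommutativeRing commutativeRing

  ring : AlmostCommutativeRing 0ℓ 0ℓ
  ring = fromCommutativeRing commutativeRing (λ _ → nothing)

  -- The solver of Tactic.RingSolver recognises exactly these operations.
  open AlmostCommutativeRing ring public
    using () renaming (_+_ to infixl 6 _⊹_; _*_ to infixl 7 _⊛_; -_ to infix 8 ⊝_)

  ⊹-inverse-unique : ∀ x y → x ⊹ y ≡ 0F → y ≡ ⊝ x
  ⊹-inverse-unique = GroupProperties.inverseʳ-unique FR.+-group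

  linear-solution : ∀ k r → ¬ k ≡ 0F → Σ F (λ x₀ → (∀ x → k ⊛ x ≡ r → x ≡ x₀) × k ⊛ x₀ ≡ r)
  linear-solution k r k≢0 with inverse k k≢0
  ... | k⁻¹ , kk⁻¹≡1 = k⁻¹ ⊛ r , unique , solves
    where
    open ≡-Reasoning
    unique : ∀ x → k ⊛ x ≡ r → x ≡ k⁻¹ ⊛ r
    unique x kx≡r = begin
      x               ≡⟨ sym (FR.*-identityˡ x) ⟩
      1F ⊛ x          ≡⟨ cong (_⊛ x) (sym (trans (FR.*-comm k⁻¹ k) kk⁻¹≡1)) ⟩
      (k⁻¹ ⊛ k) ⊛ x   ≡⟨ FR.*-assoc k⁻¹ k x ⟩
      k⁻¹ ⊛ (k ⊛ x)   ≡⟨ cong (k⁻¹ ⊛_) kx≡r ⟩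
      k⁻¹ ⊛ r         ∎
    solves : k ⊛ (k⁻¹ ⊛ r) ≡ r
    solves = trans (sym (FR.*-assoc k k⁻¹ r)) (trans (cong (_⊛ r) kk⁻¹≡1) (FR.*-identityˡ r))

  ΣF-const : (k : ℤ) → Σl elems (λ _ → k) ≡ + (2 ^ m) * k
  ΣF-const k = trans (Σl-const elems k) (cong (λ n → + n * k) elems-length)

  ΣF-single : {f : F → ℤ} (c : F) → (∀ x → ¬ x ≡ c → f x ≡ 0ℤ) → Σl elems f ≡ f c
  ΣF-single c = Σl-single elems-unique (elems-complete c)

  ΣF-𝟙-unique : {P : F → Set} (P? : ∀ x → Dec (P x)) (c : F) → (∀ x → P x → x ≡ c) → P c →
                Σl elems (λ x → 𝟙 (P? x)) ≡ 1ℤ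
  ΣF-𝟙-unique P? c unique Pc =
    trans (ΣF-single c (λ x x≢c → 𝟙-no (P? x) (x≢c ∘ unique x))) (𝟙-yes (P? c) Pc)

module CharacteristicTwo {m : ℕ} (1≤m : 1 ≤ m) (𝔽 : FiniteField m) where
  open import Data.Nat using (suc; _^_; s≤s; z≤n)
  open import Data.Integer using (ℤ; 0ℤ; 1ℤ; _+_; _*_; -_; _-_)
  import Data.Integer.Properties as ℤP
  open import Data.Integer.Tactic.RingSolver using () renaming (solve-∀ to solveℤ-∀)
  open import Tactic.RingSolver using (solve-∀)
  open import Tactic.RingSolver.Core.AlmostCommutativeRing using (AlmostCommutativeRing)
  open import Level using (0ℓ)
  open import Data.Product using (∃; _,_; proj₁; proj₂)
  open import Function using (_∘_)
  open import Data.Empty using (⊥-elim)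
  open import Relation.Binary.PropositionalEquality
  open import Relation.Nullary using (¬_; yes; no)
  open IntegerSums
  open FieldArithmetic 𝔽
  open FiniteField 𝔽 using (F; 0F; 1F; elems) renaming (_≟_ to infix 4 _≟_)

  private
    -- solve-∀ only accepts a ring defined in the module where it is invoked.
    𝔽-ring : AlmostCommutativeRing 0ℓ 0ℓ
    𝔽-ring = ring

    -- 0 is then the only fixed point of the involution x ↦ ⊝ x, whose other orbits have size two.
    card-1-even : ¬ (1F ⊹ 1F ≡ 0F) → ∃ λ k → + (2 ^ m) - 1ℤ ≡ + 2 * k
    card-1-even 2≢0 = proj₁ Σ²R-even , (begin
      + (2 ^ m) - 1ℤ
        ≡⟨ cong₂ _-_ (sym (trans (ΣF-const 1ℤ) (ℤP.*-identityʳ (+ (2 ^ m))))) (sym fixed-points) ⟩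
      Σl elems (λ _ → 1ℤ) - Σl elems (λ x → 𝟙 (x ≟ ⊝ x))
        ≡⟨ cong (_+_ (Σl elems (λ _ → 1ℤ))) (sym (Σl-neg elems (λ x → 𝟙 (x ≟ ⊝ x)))) ⟩
      Σl elems (λ _ → 1ℤ) + Σl elems (λ x → - 𝟙 (x ≟ ⊝ x))
        ≡⟨ sym (Σl-+ elems (λ _ → 1ℤ) (λ x → - 𝟙 (x ≟ ⊝ x))) ⟩
      Σl elems (λ x → 1ℤ - 𝟙 (x ≟ ⊝ x))
        ≡⟨ sym (Σl-cong elems row) ⟩
      Σl elems (λ x → Σl elems (R x))
        ≡⟨ proj₂ Σ²R-even ⟩
      + 2 * proj₁ Σ²R-even ∎)
      where
      open ≡-Reasoning
      R : F → F → ℤ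
      R x y = 𝟙 (x ⊹ y ≟ 0F) * (1ℤ - 𝟙 (x ≟ y))

      R-sym : ∀ x y → R x y ≡ R y x
      R-sym x y = cong₂ (λ a b → a * (1ℤ - b))
        (𝟙-cong (x ⊹ y ≟ 0F) (y ⊹ x ≟ 0F) (trans (FR.+-comm y x)) (trans (FR.+-comm x y)))
        (𝟙-cong (x ≟ y) (y ≟ x) sym sym)

      R-diag : ∀ x → R x x ≡ 0ℤ
      R-diag x = *-zeroʳ′ (𝟙 (x ⊹ x ≟ 0F)) (cong (_-_ 1ℤ) (𝟙-yes (x ≟ x) refl))

      row : ∀ x → Σl elems (R x) ≡ 1ℤ - 𝟙 (x ≟ ⊝ x)
      row x = trans
        (ΣF-single (⊝ x) (λ y y≢⊝x → *-zeroˡ′ (1ℤ - 𝟙 (x ≟ y)) (𝟙-no (x ⊹ y ≟ 0F) (y≢⊝x ∘ ⊹-inverse-unique x y))))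
        (*-identityˡ′ (1ℤ - 𝟙 (x ≟ ⊝ x)) (𝟙-yes (x ⊹ ⊝ x ≟ 0F) (FR.-‿inverseʳ x)))

      self-inverse⇒0 : ∀ x → x ≡ ⊝ x → x ≡ 0F
      self-inverse⇒0 x x≡⊝x with linear-solution (1F ⊹ 1F) 0F 2≢0
      ... | x₀ , unique , _ = trans (unique x 2x≡0) (sym (unique 0F (FR.zeroʳ _)))
        where
        2x≡0 : (1F ⊹ 1F) ⊛ x ≡ 0F
        2x≡0 = begin
          (1F ⊹ 1F) ⊛ x     ≡⟨ FR.distribʳ x 1F 1F ⟩
          1F ⊛ x ⊹ 1F ⊛ x   ≡⟨ cong₂ _⊹_ (FR.*-identityˡ x) (FR.*-identityˡ x) ⟩
          x ⊹ x             ≡⟨ cong (x ⊹_) x≡⊝x ⟩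
          x ⊹ ⊝ x           ≡⟨ FR.-‿inverseʳ x ⟩
          0F                ∎

      fixed-points : Σl elems (λ x → 𝟙 (x ≟ ⊝ x)) ≡ 1ℤ
      fixed-points = ΣF-𝟙-unique (λ x → x ≟ ⊝ x) 0F self-inverse⇒0
                                 (⊹-inverse-unique 0F 0F (FR.+-identityˡ 0F))

      Σ²R-even : ∃ λ k → Σl elems (λ x → Σl elems (R x)) ≡ + 2 * k
      Σ²R-even = Σ²-symmetric-even R R-sym R-diag elems

    2^m-even : ∀ {n} → 1 ≤ n → ∃ λ k → + (2 ^ n) ≡ + 2 * k
    2^m-even {suc n} (s≤s z≤n) = + (2 ^ n) , ℤP.pos-* 2 (2 ^ n)

  1+1≡0 : 1F ⊹ 1F ≡ 0F
  1+1≡0 with 1F ⊹ 1F ≟ 0F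
  ... | yes 2≡0 = 2≡0
  ... | no 2≢0 with 2^m-even 1≤m | card-1-even 2≢0
  ...   | p , q≡2p | k , q-1≡2k = ⊥-elim (+2*x≢1 (p - k) (begin
    + 2 * (p - k)               ≡⟨ expand p k ⟩
    + 2 * p - + 2 * k           ≡⟨ cong₂ (λ a b → a - b) (sym q≡2p) (sym q-1≡2k) ⟩
    + (2 ^ m) - (+ (2 ^ m) - 1ℤ) ≡⟨ cancel (+ (2 ^ m)) ⟩
    1ℤ                          ∎))
    where
    open ≡-Reasoning
    expand : ∀ p k → + 2 * (p - k) ≡ + 2 * p - + 2 * k
    expand = solveℤ-∀
    cancel : ∀ a → a - (a - 1ℤ) ≡ 1ℤ
    cancel = solveℤ-∀

  x⊹x≡0 : ∀ x → x ⊹ x ≡ 0F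
  x⊹x≡0 x = begin
    x ⊹ x             ≡⟨ sym (cong₂ _⊹_ (FR.*-identityˡ x) (FR.*-identityˡ x)) ⟩
    1F ⊛ x ⊹ 1F ⊛ x   ≡⟨ sym (FR.distribʳ x 1F 1F) ⟩
    (1F ⊹ 1F) ⊛ x     ≡⟨ cong (_⊛ x) 1+1≡0 ⟩
    0F ⊛ x            ≡⟨ FR.zeroˡ x ⟩
    0F                ∎
    where open ≡-Reasoning

  ⊝x≡x : ∀ x → ⊝ x ≡ x
  ⊝x≡x x = sym (⊹-inverse-unique x x (x⊹x≡0 x))

  x⊹y≡0⇒x≡y : ∀ {x y} → x ⊹ y ≡ 0F → x ≡ y
  x⊹y≡0⇒x≡y {x} {y} x⊹y≡0 = sym (trans (⊹-inverse-unique x y x⊹y≡0) (⊝x≡x x))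

  -- In characteristic two, x ≡ y is the equation x ⊹ y ≡ 0 and so depends only on x ⊹ y.
  ≡-by-sum : ∀ {x y x' y'} → x ⊹ y ≡ x' ⊹ y' → x ≡ y → x' ≡ y'
  ≡-by-sum {x} i refl = x⊹y≡0⇒x≡y (trans (sym i) (x⊹x≡0 x))

  𝟙-≟-by-sum : ∀ x y x' y' → x ⊹ y ≡ x' ⊹ y' → 𝟙 (x ≟ y) ≡ 𝟙 (x' ≟ y')
  𝟙-≟-by-sum x y x' y' i = 𝟙-cong (x ≟ y) (x' ≟ y') (≡-by-sum i) (≡-by-sum (sym i))

  ⊹-solveʳ : ∀ {b d a} → b ⊹ d ≡ a → d ≡ a ⊹ b
  ⊹-solveʳ {b} {d} {a} = ≡-by-sum (rearrange b d a)
    where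
    rearrange : ∀ b d a → (b ⊹ d) ⊹ a ≡ d ⊹ (a ⊹ b)
    rearrange = solve-∀ 𝔽-ring

  ⊹-cancelˡ : ∀ b a → b ⊹ (a ⊹ b) ≡ a
  ⊹-cancelˡ b a = trans (rearrange b a) (trans (cong (a ⊹_) (x⊹x≡0 b)) (FR.+-identityʳ a))
    where
    rearrange : ∀ b a → b ⊹ (a ⊹ b) ≡ a ⊹ (b ⊹ b)
    rearrange = solve-∀ 𝔽-ring

module Products {m : ℕ} (1≤m : 1 ≤ m) (𝔽 : FiniteField m)
  (L : Sym (FiniteField.F 𝔽) → Sym (FiniteField.F 𝔽) → Sym (FiniteField.F 𝔽))
  (lat : IsSymLatinDiagX L) where
  open import Level using (0ℓ)
  open import Data.Integer using (ℤ; 0ℤ; 1ℤ; _+_; _*_; -_; _-_)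
  import Data.Integer.Properties as ℤP
  open import Data.Integer.Tactic.RingSolver using () renaming (solve-∀ to solveℤ-∀)
  open import Tactic.RingSolver using (solve-∀)
  open import Tactic.RingSolver.Core.AlmostCommutativeRing using (AlmostCommutativeRing)
  open import Data.List using ([]; _∷_; _++_; map; cartesianProduct)
  open import Data.List.Membership.Propositional using (_∈_)
  open import Data.List.Membership.Propositional.Properties using (∈-map⁺; ∈-map⁻; ∈-++⁺ˡ; ∈-++⁺ʳ)
  open import Data.List.Relation.Unary.Any using (here; there)
  open import Data.List.Relation.Unary.All using ([]; _∷_)
  open import Data.List.Relation.Unary.AllPairs using ([]; _∷_)
  open import Data.List.Relation.Unary.Unique.Propositional using (Unique)
  open import Data.List.Relation.Unary.Unique.Propositional.Properties using (map⁺; ++⁺)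
  open import Data.Product using (_,_; proj₁; proj₂)
  open import Data.Empty using (⊥-elim)
  open import Function using (_∘_)
  open import Relation.Binary.PropositionalEquality
  open import Relation.Binary.Definitions using (DecidableEquality)
  open import Relation.Nullary using (¬_; Dec; yes; no)
  open IntegerSums
  open FieldArithmetic 𝔽
  open CharacteristicTwo 1≤m 𝔽
  open FiniteField 𝔽 using (F; 0F; elems; elems-unique; elems-complete) renaming (_≟_ to infix 4 _≟_)
  open Construction 𝔽 L
  open IsSymLatinDiagX lat

  private
    𝔽-ring : AlmostCommutativeRing 0ℓ 0ℓ
    𝔽-ring = ring

  infix 4 _≟s_
  _≟s_ : DecidableEquality S
  _≟s_ = _≟S_ _≟_

  el-injective : ∀ {a b : F} → el a ≡ el b → a ≡ b
  el-injective refl = refl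

  elemsS-unique : Unique elemsS
  elemsS-unique = ++⁺ (map⁺ el-injective elems-unique) (((λ ()) ∷ []) ∷ [] ∷ []) disjoint
    where
    disjoint : ∀ {v} → ¬ (v ∈ map el elems × v ∈ xS ∷ yS ∷ [])
    disjoint (v∈els , v∈xy) with ∈-map⁻ el v∈els | v∈xy
    ... | _ , _ , refl | here ()
    ... | _ , _ , refl | there (here ())

  elemsS-complete : ∀ s → s ∈ elemsS
  elemsS-complete (el a) = ∈-++⁺ˡ (∈-map⁺ el (elems-complete a))
  elemsS-complete xS     = ∈-++⁺ʳ (map el elems) (here refl)
  elemsS-complete yS     = ∈-++⁺ʳ (map el elems) (there (here refl))

  ΣS-single : ∀ {f : S → ℤ} c → (∀ t → ¬ t ≡ c → f t ≡ 0ℤ) → Σl elemsS f ≡ f c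
  ΣS-single c = Σl-single elemsS-unique (elemsS-complete c)

  ΣS-select : ∀ c (f : S → ℤ) → Σl elemsS (λ t → 𝟙 (t ≟s c) * f t) ≡ f c
  ΣS-select c f = trans (ΣS-single c (λ t t≢c → *-zeroˡ′ (f t) (𝟙-no (t ≟s c) t≢c)))
                        (*-identityˡ′ (f c) (𝟙-yes (c ≟s c) refl))

  ΣS-split : ∀ (f : S → ℤ) → Σl elemsS f ≡ Σl elems (f ∘ el) + (f xS + (f yS + 0ℤ))
  ΣS-split f = trans (Σl-++ (map el elems) (xS ∷ yS ∷ []) f) (cong (_+ (f xS + (f yS + 0ℤ))) (Σl-map elems el f))

  ΣF-select : ∀ x (k : ℤ) → Σl elems (λ γ → k * 𝟙 (x ≟ γ)) ≡ k
  ΣF-select x k = trans (Σl-* elems k (λ γ → 𝟙 (x ≟ γ)))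
    (trans (cong (k *_) (ΣF-𝟙-unique (x ≟_) x (λ _ → sym) refl)) (ℤP.*-identityʳ k))

  row-reindex : ∀ s (G : S → ℤ) → Σl elemsS (G ∘ L s) ≡ Σl elemsS G
  row-reindex s = Σl-reindex _≟s_ elemsS-unique elemsS-complete (L s) (row-unique s)

  row-injective : ∀ {t s s'} → L t s ≡ L t s' → s ≡ s'
  row-injective {t} {s} {s'} Lts≡Lts' with row-unique t (L t s)
  ... | _ , _ , unique = trans (unique s refl) (sym (unique s' (sym Lts≡Lts')))

  col-injective : ∀ {s s' t} → L s t ≡ L s' t → s ≡ s'
  col-injective {s} {s'} {t} e = row-injective (trans (symmetric t s) (trans e (symmetric s' t)))

  L≡x⇒≡ : ∀ {s t} → L s t ≡ xS → t ≡ s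
  L≡x⇒≡ {s} e = row-injective (trans e (sym (diagonal s)))

  -- P_y is the permutation matrix of y-partner.
  y-partner : S → S
  y-partner s = proj₁ (row-unique s yS)

  L-y-partner : ∀ s → L s (y-partner s) ≡ yS
  L-y-partner s = proj₁ (proj₂ (row-unique s yS))

  L-y-partnerˡ : ∀ s → L (y-partner s) s ≡ yS
  L-y-partnerˡ s = trans (symmetric (y-partner s) s) (L-y-partner s)

  y-partner-unique : ∀ {s t} → L s t ≡ yS → t ≡ y-partner s
  y-partner-unique {s} {t} = proj₂ (proj₂ (row-unique s yS)) t

  el≢x : ∀ {a : F} → ¬ el a ≡ xS
  el≢x ()

  el≢y : ∀ {a : F} → ¬ el a ≡ yS
  el≢y ()

  inF : S → ℤ
  inF (el _) = 1ℤ
  inF xS     = 0ℤ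
  inF yS     = 0ℤ

  ΣS-inF : Σl elemsS inF ≡ q
  ΣS-inF = trans (ΣS-split inF) (trans (ℤP.+-identityʳ _) (trans (ΣF-const 1ℤ) (ℤP.*-identityʳ q)))

  row-partition : ∀ s t → (inF (L s t) + 𝟙 (t ≟s s)) + 𝟙 (t ≟s y-partner s) ≡ 1ℤ
  row-partition s t with L s t in e
  ... | el a = cong₂ (λ i j → (1ℤ + i) + j)
                 (𝟙-no (t ≟s s) (λ { refl → el≢x (trans (sym e) (diagonal s)) }))
                 (𝟙-no (t ≟s y-partner s) (λ { refl → el≢y (trans (sym e) (L-y-partner s)) }))
  ... | xS = cong₂ (λ i j → (0ℤ + i) + j)
                 (𝟙-yes (t ≟s s) (L≡x⇒≡ e))
                 (𝟙-no (t ≟s y-partner s) (λ { refl → x≢y (trans (sym e) (L-y-partner s)) }))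
    where
    x≢y : ¬ xS ≡ yS
    x≢y ()
  ... | yS = cong₂ (λ i j → (0ℤ + i) + j)
                 (𝟙-no (t ≟s s) (λ { refl → y≢x (trans (sym e) (diagonal s)) }))
                 (𝟙-yes (t ≟s y-partner s) (y-partner-unique e))
    where
    y≢x : ¬ yS ≡ xS
    y≢x ()

  Σ-row-inF : ∀ s (f : S → ℤ) →
              Σl elemsS (λ t → inF (L s t) * f t) ≡ Σl elemsS f - f s - f (y-partner s)
  Σ-row-inF s f = begin
    Σl elemsS (λ t → inF (L s t) * f t)
      ≡⟨ isolate _ (f s) (f (y-partner s)) ⟩
    (Σl elemsS (λ t → inF (L s t) * f t) + f s + f (y-partner s)) - f s - f (y-partner s)
      ≡⟨ cong (λ w → w - f s - f (y-partner s)) (sym split) ⟩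
    Σl elemsS f - f s - f (y-partner s) ∎
    where
    open ≡-Reasoning
    isolate : ∀ a b c → a ≡ (a + b + c) - b - c
    isolate = solveℤ-∀
    distribute : ∀ i j k x → i + j + k ≡ 1ℤ → x ≡ i * x + j * x + k * x
    distribute i j k x p = trans (sym (trans (cong (_* x) p) (ℤP.*-identityˡ x))) (expand i j k x)
      where
      expand : ∀ i j k x → (i + j + k) * x ≡ i * x + j * x + k * x
      expand = solveℤ-∀
    split : Σl elemsS f ≡ Σl elemsS (λ t → inF (L s t) * f t) + f s + f (y-partner s)
    split = begin
      Σl elemsS f
        ≡⟨ Σl-cong elemsS (λ t → distribute (inF (L s t)) (𝟙 (t ≟s s)) (𝟙 (t ≟s y-partner s)) (f t) (row-partition s t)) ⟩
      Σl elemsS (λ t → inF (L s t) * f t + 𝟙 (t ≟s s) * f t + 𝟙 (t ≟s y-partner s) * f t)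
        ≡⟨ trans (Σl-+ elemsS (λ t → inF (L s t) * f t + 𝟙 (t ≟s s) * f t) (λ t → 𝟙 (t ≟s y-partner s) * f t))
                 (cong (_+ Σl elemsS (λ t → 𝟙 (t ≟s y-partner s) * f t))
                       (Σl-+ elemsS (λ t → inF (L s t) * f t) (λ t → 𝟙 (t ≟s s) * f t))) ⟩
      Σl elemsS (λ t → inF (L s t) * f t) + Σl elemsS (λ t → 𝟙 (t ≟s s) * f t)
        + Σl elemsS (λ t → 𝟙 (t ≟s y-partner s) * f t)
        ≡⟨ cong₂ (λ i j → Σl elemsS (λ t → inF (L s t) * f t) + i + j) (ΣS-select s f) (ΣS-select (y-partner s) f) ⟩
      Σl elemsS (λ t → inF (L s t) * f t) + f s + f (y-partner s) ∎

  φ-entry : ∀ z γ γ' → φ z γ γ' ≡ 𝟙 (γ ⊹ γ' ≟ z)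
  φ-entry z γ γ' with γ ⊹ γ' ≟ z
  ... | yes _ = refl
  ... | no _  = refl

  P-entry : ∀ a t t' → P a t t' ≡ 𝟙 (L t t' ≟s a)
  P-entry a t t' with L t t' ≟s a
  ... | yes _ = refl
  ... | no _  = refl

  -- the (b, c), (b', c') entry of C_{a,α}; 0 on the blocks labelled x and y
  block : S → F → F → F → F → F → ℤ
  block (el a) α b c b' c' = 𝟙 (c ⊹ c' ≟ a ⊛ (b ⊹ b') ⊹ α)
  block xS     α b c b' c' = 0ℤ
  block yS     α b c b' c' = 0ℤ

  block-outside : ∀ {z} α b c b' c' → inF z ≡ 0ℤ → block z α b c b' c' ≡ 0ℤ
  block-outside {xS} α b c b' c' _ = refl
  block-outside {yS} α b c b' c' _ = refl

  A0-entry : ∀ α s b c s' b' c' →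
    A0 α (s , (b , c)) (s' , (b' , c')) ≡ (𝟙 (s ≟s s') * 𝟙 (b ≟ b')) * 𝟙 (c ⊹ c' ≟ α)
  A0-entry α s b c s' b' c' = cong₂ _*_ (cong₂ _*_ (δ≡𝟙 _≟s_ s s') (δ≡𝟙 _≟_ b b')) (φ-entry α c c')

  A1-entry : ∀ α s b c s' b' c' → A1 α (s , (b , c)) (s' , (b' , c')) ≡ 𝟙 (s ≟s s') * 𝟙 (b ⊹ b' ≟ α)
  A1-entry α s b c s' b' c' = cong₂ _*_ (δ≡𝟙 _≟s_ s s') (trans (ℤP.*-identityʳ _) (φ-entry α b b'))

  A2-entry : ∀ α s b c s' b' c' → A2 α (s , (b , c)) (s' , (b' , c')) ≡ 𝟙 (L s s' ≟s yS) * 𝟙 (b ⊹ b' ≟ α)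
  A2-entry α s b c s' b' c' = cong₂ _*_ (P-entry yS s s') (trans (ℤP.*-identityʳ _) (φ-entry α b b'))

  A3-entry : ∀ α s b c s' b' c' → A3 α (s , (b , c)) (s' , (b' , c')) ≡ block (L s s') α b c b' c'
  A3-entry α s b c s' b' c' = begin
    N α u v + - (P yS s s' * Y)
      ≡⟨ cong (λ w → w + - (P yS s s' * Y)) N-entry ⟩
    (Σl elems (λ a → P (el a) s s' * C a α (b , c) (b' , c')) + (P yS s s' * Y + 0ℤ)) + - (P yS s s' * Y)
      ≡⟨ cancel _ (P yS s s' * Y) ⟩
    Σl elems (λ a → P (el a) s s' * C a α (b , c) (b' , c'))
      ≡⟨ Σl-cong elems (λ a → cong₂ _*_ (P-entry (el a) s s') (C-entry a)) ⟩
    Σl elems (λ a → 𝟙 (L s s' ≟s el a) * block (el a) α b c b' c')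
      ≡⟨ select (L s s') ⟩
    block (L s s') α b c b' c' ∎
    where
    open ≡-Reasoning
    u v : Ix
    u = s , (b , c)
    v = s' , (b' , c')
    Y : ℤ
    Y = CS yS α (b , c) (b' , c')
    cancel : ∀ x y → (x + (y + 0ℤ)) + - y ≡ x
    cancel = solveℤ-∀
    N-entry : N α u v ≡ Σl elems (λ a → P (el a) s s' * C a α (b , c) (b' , c')) + (P yS s s' * Y + 0ℤ)
    N-entry = trans (ΣM-apply (map el elems ++ (yS ∷ [])) (λ a → P a ⊗ CS a α) u v)
      (trans (Σl-++ (map el elems) (yS ∷ []) (λ a → P a s s' * CS a α (b , c) (b' , c')))
             (cong (_+ (P yS s s' * Y + 0ℤ)) (Σl-map elems el (λ a → P a s s' * CS a α (b , c) (b' , c')))))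
    C-entry : ∀ a → C a α (b , c) (b' , c') ≡ block (el a) α b c b' c'
    C-entry a = trans (φ-entry _ c c') (cong (λ w → 𝟙 (c ⊹ c' ≟ a ⊛ (w ⊹ b') ⊹ α)) (⊝x≡x b))
    select : ∀ z → Σl elems (λ a → 𝟙 (z ≟s el a) * block (el a) α b c b' c') ≡ block z α b c b' c'
    select (el a₀) = trans
      (ΣF-single a₀ (λ a a≢a₀ → *-zeroˡ′ (block (el a) α b c b' c') (𝟙-no (el a₀ ≟s el a) (a≢a₀ ∘ sym ∘ el-injective))))
      (*-identityˡ′ (block (el a₀) α b c b' c') (𝟙-yes (el a₀ ≟s el a₀) refl))
    select xS = Σl-zero elems (λ a → refl)
    select yS = Σl-zero elems (λ a → refl)

  ∙-entry : ∀ (A B : Mat Ix) u v → (A ∙ B) u v ≡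
    Σl elemsS (λ t → Σl elems (λ d → Σl elems (λ e → A u (t , (d , e)) * B (t , (d , e)) v)))
  ∙-entry A B u v = trans (Σl-cartesianProduct elemsS (cartesianProduct elems elems) (λ w → A u w * B w v))
    (Σl-cong elemsS (λ t → Σl-cartesianProduct elems elems (λ de → A u (t , de) * B (t , de) v)))

  A0-∙ : ∀ α (M : Mat Ix) s b c v → (A0 α ∙ M) (s , (b , c)) v ≡ M (s , (b , α ⊹ c)) v
  A0-∙ α M s b c v = begin
    (A0 α ∙ M) u v
      ≡⟨ ∙-entry (A0 α) M u v ⟩
    Σl elemsS (λ t → Σl elems (λ d → Σl elems (λ e → A0 α u (t , (d , e)) * M (t , (d , e)) v)))
      ≡⟨ ΣS-single s (λ t t≢s → Σl-zero elems (λ d → Σl-zero elems (λ e → *-zeroˡ′ (M (t , (d , e)) v)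
           (trans (A0-entry α s b c t d e) (*-zeroˡ′ (𝟙 (c ⊹ e ≟ α)) (*-zeroˡ′ (𝟙 (b ≟ d)) (𝟙-no (s ≟s t) (t≢s ∘ sym)))))))) ⟩
    Σl elems (λ d → Σl elems (λ e → A0 α u (s , (d , e)) * M (s , (d , e)) v))
      ≡⟨ ΣF-single b (λ d d≢b → Σl-zero elems (λ e → *-zeroˡ′ (M (s , (d , e)) v)
           (trans (A0-entry α s b c s d e) (*-zeroˡ′ (𝟙 (c ⊹ e ≟ α)) (*-zeroʳ′ (𝟙 (s ≟s s)) (𝟙-no (b ≟ d) (d≢b ∘ sym))))))) ⟩
    Σl elems (λ e → A0 α u (s , (b , e)) * M (s , (b , e)) v)
      ≡⟨ ΣF-single (α ⊹ c) (λ e e≢α+c → *-zeroˡ′ (M (s , (b , e)) v)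
           (trans (A0-entry α s b c s b e) (*-zeroʳ′ (𝟙 (s ≟s s) * 𝟙 (b ≟ b)) (𝟙-no (c ⊹ e ≟ α) (e≢α+c ∘ ⊹-solveʳ))))) ⟩
    A0 α u (s , (b , α ⊹ c)) * M (s , (b , α ⊹ c)) v
      ≡⟨ *-identityˡ′ (M (s , (b , α ⊹ c)) v) A0-diagonal ⟩
    M (s , (b , α ⊹ c)) v ∎
    where
    open ≡-Reasoning
    u : Ix
    u = s , (b , c)
    A0-diagonal : A0 α u (s , (b , α ⊹ c)) ≡ 1ℤ
    A0-diagonal = trans (A0-entry α s b c s b (α ⊹ c))
      (trans (cong₂ (λ i j → (i * j) * 𝟙 (c ⊹ (α ⊹ c) ≟ α)) (𝟙-yes (s ≟s s) refl) (𝟙-yes (b ≟ b) refl))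
             (trans (*-identityˡ′ (𝟙 (c ⊹ (α ⊹ c) ≟ α)) refl) (𝟙-yes (c ⊹ (α ⊹ c) ≟ α) (⊹-cancelˡ c α))))

  selector-∙ : ∀ (A M : Mat Ix) (g : S → ℤ) t₀ α s b c v → (∀ t → ¬ t ≡ t₀ → g t ≡ 0ℤ) → g t₀ ≡ 1ℤ →
               (∀ t d e → A (s , (b , c)) (t , (d , e)) ≡ g t * 𝟙 (b ⊹ d ≟ α)) →
               (A ∙ M) (s , (b , c)) v ≡ Σl elems (λ e → M (t₀ , (α ⊹ b , e)) v)
  selector-∙ A M g t₀ α s b c v g≡0 g≡1 A-entry = begin
    (A ∙ M) u v
      ≡⟨ ∙-entry A M u v ⟩
    Σl elemsS (λ t → Σl elems (λ d → Σl elems (λ e → A u (t , (d , e)) * M (t , (d , e)) v)))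
      ≡⟨ ΣS-single t₀ (λ t t≢t₀ → Σl-zero elems (λ d → Σl-zero elems (λ e → *-zeroˡ′ (M (t , (d , e)) v)
           (trans (A-entry t d e) (*-zeroˡ′ (𝟙 (b ⊹ d ≟ α)) (g≡0 t t≢t₀)))))) ⟩
    Σl elems (λ d → Σl elems (λ e → A u (t₀ , (d , e)) * M (t₀ , (d , e)) v))
      ≡⟨ ΣF-single (α ⊹ b) (λ d d≢α+b → Σl-zero elems (λ e → *-zeroˡ′ (M (t₀ , (d , e)) v)
           (trans (A-entry t₀ d e) (*-zeroʳ′ (g t₀) (𝟙-no (b ⊹ d ≟ α) (d≢α+b ∘ ⊹-solveʳ)))))) ⟩
    Σl elems (λ e → A u (t₀ , (α ⊹ b , e)) * M (t₀ , (α ⊹ b , e)) v)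
      ≡⟨ Σl-cong elems (λ e → *-identityˡ′ (M (t₀ , (α ⊹ b , e)) v) (trans (A-entry t₀ (α ⊹ b) e)
           (cong₂ _*_ g≡1 (𝟙-yes (b ⊹ (α ⊹ b) ≟ α) (⊹-cancelˡ b α))))) ⟩
    Σl elems (λ e → M (t₀ , (α ⊹ b , e)) v) ∎
    where
    open ≡-Reasoning
    u : Ix
    u = s , (b , c)

  A1-∙ : ∀ α (M : Mat Ix) s b c v → (A1 α ∙ M) (s , (b , c)) v ≡ Σl elems (λ e → M (s , (α ⊹ b , e)) v)
  A1-∙ α M s b c v = selector-∙ (A1 α) M (λ t → 𝟙 (s ≟s t)) s α s b c v
    (λ t t≢s → 𝟙-no (s ≟s t) (t≢s ∘ sym)) (𝟙-yes (s ≟s s) refl) (A1-entry α s b c)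

  A2-∙ : ∀ α (M : Mat Ix) s b c v →
         (A2 α ∙ M) (s , (b , c)) v ≡ Σl elems (λ e → M (y-partner s , (α ⊹ b , e)) v)
  A2-∙ α M s b c v = selector-∙ (A2 α) M (λ t → 𝟙 (L s t ≟s yS)) (y-partner s) α s b c v
    (λ t t≢ty → 𝟙-no (L s t ≟s yS) (t≢ty ∘ y-partner-unique)) (𝟙-yes (L s (y-partner s) ≟s yS) (L-y-partner s))
    (A2-entry α s b c)

  𝟙-shift : ∀ α β x x' → 𝟙 ((α ⊹ x) ⊹ x' ≟ β) ≡ 𝟙 (x ⊹ x' ≟ α ⊹ β)
  𝟙-shift α β x x' = 𝟙-≟-by-sum _ _ _ _ (rearrange α x x' β)
    where
    rearrange : ∀ α x x' β → ((α ⊹ x) ⊹ x') ⊹ β ≡ (x ⊹ x') ⊹ (α ⊹ β)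
    rearrange = solve-∀ 𝔽-ring

  A0∙A0 : ∀ α β → (A0 α ∙ A0 β) ≋ A0 (α ⊹ β)
  A0∙A0 α β (s , (b , c)) (s' , (b' , c')) = begin
    (A0 α ∙ A0 β) (s , (b , c)) (s' , (b' , c'))       ≡⟨ A0-∙ α (A0 β) s b c (s' , (b' , c')) ⟩
    A0 β (s , (b , α ⊹ c)) (s' , (b' , c'))            ≡⟨ A0-entry β s b (α ⊹ c) s' b' c' ⟩
    (𝟙 (s ≟s s') * 𝟙 (b ≟ b')) * 𝟙 (α ⊹ c ⊹ c' ≟ β)   ≡⟨ cong (𝟙 (s ≟s s') * 𝟙 (b ≟ b') *_) (𝟙-shift α β c c') ⟩
    (𝟙 (s ≟s s') * 𝟙 (b ≟ b')) * 𝟙 (c ⊹ c' ≟ α ⊹ β)   ≡⟨ sym (A0-entry (α ⊹ β) s b c s' b' c') ⟩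
    A0 (α ⊹ β) (s , (b , c)) (s' , (b' , c'))          ∎
    where open ≡-Reasoning

  A0∙A1 : ∀ α β → (A0 α ∙ A1 β) ≋ A1 β
  A0∙A1 α β (s , (b , c)) = A0-∙ α (A1 β) s b c

  A0∙A2 : ∀ α β → (A0 α ∙ A2 β) ≋ A2 β
  A0∙A2 α β (s , (b , c)) = A0-∙ α (A2 β) s b c

  block-shift : ∀ z α β b c b' c' → block z β b (α ⊹ c) b' c' ≡ block z (α ⊹ β) b c b' c'
  block-shift (el a) α β b c b' c' = 𝟙-≟-by-sum _ _ _ _ (rearrange α c c' (a ⊛ (b ⊹ b')) β)
    where
    rearrange : ∀ α c c' w β → ((α ⊹ c) ⊹ c') ⊹ (w ⊹ β) ≡ (c ⊹ c') ⊹ (w ⊹ (α ⊹ β))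
    rearrange = solve-∀ 𝔽-ring
  block-shift xS α β b c b' c' = refl
  block-shift yS α β b c b' c' = refl

  A0∙A3 : ∀ α β → (A0 α ∙ A3 β) ≋ A3 (α ⊹ β)
  A0∙A3 α β (s , (b , c)) (s' , (b' , c')) = begin
    (A0 α ∙ A3 β) (s , (b , c)) (s' , (b' , c'))  ≡⟨ A0-∙ α (A3 β) s b c (s' , (b' , c')) ⟩
    A3 β (s , (b , α ⊹ c)) (s' , (b' , c'))       ≡⟨ A3-entry β s b (α ⊹ c) s' b' c' ⟩
    block (L s s') β b (α ⊹ c) b' c'              ≡⟨ block-shift (L s s') α β b c b' c' ⟩
    block (L s s') (α ⊹ β) b c b' c'              ≡⟨ sym (A3-entry (α ⊹ β) s b c s' b' c') ⟩
    A3 (α ⊹ β) (s , (b , c)) (s' , (b' , c'))     ∎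
    where open ≡-Reasoning

  ΣF-const-shift : ∀ (g : ℤ) α β b b' → Σl elems (λ _ → g * 𝟙 ((α ⊹ b) ⊹ b' ≟ β)) ≡ q * (g * 𝟙 (b ⊹ b' ≟ α ⊹ β))
  ΣF-const-shift g α β b b' = trans (ΣF-const _) (cong (λ i → q * (g * i)) (𝟙-shift α β b b'))

  A1∙A1 : ∀ α β → (A1 α ∙ A1 β) ≋ (q · A1 (α ⊹ β))
  A1∙A1 α β (s , (b , c)) (s' , (b' , c')) =
    trans (A1-∙ α (A1 β) s b c (s' , (b' , c')))
    (trans (Σl-cong elems (λ e → A1-entry β s (α ⊹ b) e s' b' c'))
    (trans (ΣF-const-shift (𝟙 (s ≟s s')) α β b b')
           (cong (q *_) (sym (A1-entry (α ⊹ β) s b c s' b' c')))))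

  P-y-partner : ∀ s s' → 𝟙 (L (y-partner s) s' ≟s yS) ≡ 𝟙 (s ≟s s')
  P-y-partner s s' = 𝟙-cong (L (y-partner s) s' ≟s yS) (s ≟s s')
    (λ e → sym (row-injective (trans e (sym (L-y-partnerˡ s))))) (λ { refl → L-y-partnerˡ s })

  A2∙A2 : ∀ α β → (A2 α ∙ A2 β) ≋ (q · A1 (α ⊹ β))
  A2∙A2 α β (s , (b , c)) (s' , (b' , c')) =
    trans (A2-∙ α (A2 β) s b c (s' , (b' , c')))
    (trans (Σl-cong elems (λ e → A2-entry β (y-partner s) (α ⊹ b) e s' b' c'))
    (trans (ΣF-const-shift (𝟙 (L (y-partner s) s' ≟s yS)) α β b b')
           (cong (q *_) (trans (cong (_* 𝟙 (b ⊹ b' ≟ α ⊹ β)) (P-y-partner s s'))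
                               (sym (A1-entry (α ⊹ β) s b c s' b' c'))))))

  A1∙A2 : ∀ α β → (A1 α ∙ A2 β) ≋ (q · A2 (α ⊹ β))
  A1∙A2 α β (s , (b , c)) (s' , (b' , c')) =
    trans (A1-∙ α (A2 β) s b c (s' , (b' , c')))
    (trans (Σl-cong elems (λ e → A2-entry β s (α ⊹ b) e s' b' c'))
    (trans (ΣF-const-shift (𝟙 (L s s' ≟s yS)) α β b b')
           (cong (q *_) (sym (A2-entry (α ⊹ β) s b c s' b' c')))))

  block-Σ-column : ∀ z β d b' c' → Σl elems (λ e → block z β d e b' c') ≡ inF z
  block-Σ-column (el a) β d b' c' =
    ΣF-𝟙-unique (λ e → e ⊹ c' ≟ w) (w ⊹ c') (λ e → ⊹-solveʳ ∘ trans (FR.+-comm c' e))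
                (trans (FR.+-comm (w ⊹ c') c') (⊹-cancelˡ c' w))
    where
    w : F
    w = a ⊛ (d ⊹ b') ⊹ β
  block-Σ-column xS β d b' c' = Σl-zero elems (λ _ → refl)
  block-Σ-column yS β d b' c' = Σl-zero elems (λ _ → refl)

  block-Σ-parameter : ∀ z b c b' c' → Σl elems (λ γ → block z γ b c b' c') ≡ inF z
  block-Σ-parameter (el a) b c b' c' =
    ΣF-𝟙-unique (λ γ → x ≟ w ⊹ γ) (w ⊹ x) (λ γ p → trans (⊹-solveʳ (sym p)) (FR.+-comm x w)) (sym (⊹-cancelˡ′ w x))
    where
    w x : F
    w = a ⊛ (b ⊹ b')
    x = c ⊹ c'
    ⊹-cancelˡ′ : ∀ w x → w ⊹ (w ⊹ x) ≡ x
    ⊹-cancelˡ′ w x = trans (cong (w ⊹_) (FR.+-comm w x)) (⊹-cancelˡ w x)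
  block-Σ-parameter xS b c b' c' = Σl-zero elems (λ _ → refl)
  block-Σ-parameter yS b c b' c' = Σl-zero elems (λ _ → refl)

  ΣA3-entry : ∀ s b c s' b' c' → ΣF A3 (s , (b , c)) (s' , (b' , c')) ≡ inF (L s s')
  ΣA3-entry s b c s' b' c' = trans (ΣM-apply elems A3 _ _)
    (trans (Σl-cong elems (λ γ → A3-entry γ s b c s' b' c')) (block-Σ-parameter (L s s') b c b' c'))

  inF-y-partner : ∀ s s' → inF (L (y-partner s) s') ≡ inF (L s s')
  inF-y-partner s s' with L s s' in e | L (y-partner s) s' in e'
  ... | el _ | el _ = refl
  ... | el _ | xS   = ⊥-elim (el≢y (trans (sym e) (trans (cong (L s) (L≡x⇒≡ e')) (L-y-partner s))))
  ... | el _ | yS   = ⊥-elim (el≢x (trans (sym e) (trans (cong (L s) (row-injective (trans e' (sym (L-y-partnerˡ s))))) (diagonal s))))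
  ... | xS   | el _ = ⊥-elim (el≢y (trans (sym e') (trans (cong (L (y-partner s)) (L≡x⇒≡ e)) (L-y-partnerˡ s))))
  ... | xS   | xS   = refl
  ... | xS   | yS   = refl
  ... | yS   | el _ = ⊥-elim (el≢x (trans (sym e') (trans (cong (L (y-partner s)) (y-partner-unique e)) (diagonal (y-partner s)))))
  ... | yS   | xS   = refl
  ... | yS   | yS   = refl

  A1∙A3 : ∀ α β → (A1 α ∙ A3 β) ≋ ΣF A3
  A1∙A3 α β (s , (b , c)) (s' , (b' , c')) =
    trans (A1-∙ α (A3 β) s b c (s' , (b' , c')))
    (trans (Σl-cong elems (λ e → A3-entry β s (α ⊹ b) e s' b' c'))
    (trans (block-Σ-column (L s s') β (α ⊹ b) b' c') (sym (ΣA3-entry s b c s' b' c'))))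

  A2∙A3 : ∀ α β → (A2 α ∙ A3 β) ≋ ΣF A3
  A2∙A3 α β (s , (b , c)) (s' , (b' , c')) =
    trans (A2-∙ α (A3 β) s b c (s' , (b' , c')))
    (trans (Σl-cong elems (λ e → A3-entry β (y-partner s) (α ⊹ b) e s' b' c'))
    (trans (block-Σ-column (L (y-partner s) s') β (α ⊹ b) b' c')
    (trans (inF-y-partner s s') (sym (ΣA3-entry s b c s' b' c')))))

  A3²-rhs : F → F → Mat Ix
  A3²-rhs α β = ((q * q) · A0 (α ⊹ β)) ⊕ ΣF (λ γ → (q · ((⊖ A0 γ) ⊕ A1 γ ⊕ A2 γ)) ⊕ ((q - + 2) · A3 γ))

  module A3-square (α β : F) (s : S) (b c : F) (s' : S) (b' c' : F) where
    blockProduct : S → S → ℤ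
    blockProduct z z' = Σl elems (λ d → Σl elems (λ e → block z α b c d e * block z' β d e b' c'))

    offset : F → F → F
    offset a a' = a ⊛ b ⊹ a' ⊛ b' ⊹ α ⊹ β ⊹ c ⊹ c'

    -- e is determined by d through the first block, leaving one linear equation for d.
    blockProduct-el : ∀ a a' → blockProduct (el a) (el a') ≡ Σl elems (λ d → 𝟙 ((a ⊹ a') ⊛ d ≟ offset a a'))
    blockProduct-el a a' = Σl-cong elems inner
      where
      rearrange : ∀ a a' b b' d α β c c' → (((a ⊛ (b ⊹ d) ⊹ α) ⊹ c) ⊹ c') ⊹ (a' ⊛ (d ⊹ b') ⊹ β)
                  ≡ (a ⊹ a') ⊛ d ⊹ (a ⊛ b ⊹ a' ⊛ b' ⊹ α ⊹ β ⊹ c ⊹ c')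
      rearrange = solve-∀ 𝔽-ring
      inner : ∀ d → Σl elems (λ e → block (el a) α b c d e * block (el a') β d e b' c') ≡ 𝟙 ((a ⊹ a') ⊛ d ≟ offset a a')
      inner d = trans
        (ΣF-single (w ⊹ c) (λ e e≢w+c → *-zeroˡ′ (block (el a') β d e b' c') (𝟙-no (c ⊹ e ≟ w) (e≢w+c ∘ ⊹-solveʳ))))
        (trans (*-identityˡ′ (block (el a') β d (w ⊹ c) b' c') (𝟙-yes (c ⊹ (w ⊹ c) ≟ w) (⊹-cancelˡ c w)))
               (𝟙-≟-by-sum _ _ _ _ (rearrange a a' b b' d α β c c')))
        where
        w : F
        w = a ⊛ (b ⊹ d) ⊹ α

    blockProduct-distinct : ∀ a a' → ¬ a ≡ a' → blockProduct (el a) (el a') ≡ 1ℤ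
    blockProduct-distinct a a' a≢a' with linear-solution (a ⊹ a') (offset a a') (a≢a' ∘ x⊹y≡0⇒x≡y)
    ... | d₀ , unique , solves = trans (blockProduct-el a a')
                                       (ΣF-𝟙-unique (λ d → (a ⊹ a') ⊛ d ≟ offset a a') d₀ unique solves)

    blockProduct-same : ∀ a → blockProduct (el a) (el a) ≡ q * 𝟙 (0F ≟ offset a a)
    blockProduct-same a = trans (blockProduct-el a a)
      (trans (Σl-cong elems (λ d → cong (λ w → 𝟙 (w ≟ offset a a)) (trans (cong (_⊛ d) (x⊹x≡0 a)) (FR.zeroˡ d))))
             (ΣF-const _))

    blockProduct-outsideˡ : ∀ z z' → inF z ≡ 0ℤ → blockProduct z z' ≡ 0ℤ
    blockProduct-outsideˡ z z' z∉F = Σl-zero elems (λ d → Σl-zero elems (λ e →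
      *-zeroˡ′ (block z' β d e b' c') (block-outside α b c d e z∉F)))

    blockProduct-outsideʳ : ∀ z z' → inF z' ≡ 0ℤ → blockProduct z z' ≡ 0ℤ
    blockProduct-outsideʳ z z' z'∉F = Σl-zero elems (λ d → Σl-zero elems (λ e →
      *-zeroʳ′ (block z α b c d e) (block-outside β d e b' c' z'∉F)))

    u v : Ix
    u = s , (b , c)
    v = s' , (b' , c')

    product-entry : (A3 α ∙ A3 β) u v ≡ Σl elemsS (λ t → blockProduct (L s t) (L t s'))
    product-entry = trans (∙-entry (A3 α) (A3 β) u v)
      (Σl-cong elemsS (λ t → Σl-cong elems (λ d → Σl-cong elems (λ e →
         cong₂ _*_ (A3-entry α s b c t d e) (A3-entry β t d e s' b' c')))))

    rhs : ℤ → ℤ → ℤ → ℤ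
    rhs i p f = q * q * ((i * 𝟙 (b ≟ b')) * 𝟙 (c ⊹ c' ≟ α ⊹ β)) + (q * ((- (i * 𝟙 (b ≟ b')) + i) + p) + (q - + 2) * f)

    RHS-entry : A3²-rhs α β u v ≡ rhs (𝟙 (s ≟s s')) (𝟙 (L s s' ≟s yS)) (inF (L s s'))
    RHS-entry = cong₂ _+_ (cong (q * q *_) (A0-entry (α ⊹ β) s b c s' b' c'))
      (trans (ΣM-apply elems (λ γ → (q · ((⊖ A0 γ) ⊕ A1 γ ⊕ A2 γ)) ⊕ ((q - + 2) · A3 γ)) u v)
      (trans (linear (λ γ → A0 γ u v) (λ γ → A1 γ u v) (λ γ → A2 γ u v) (λ γ → A3 γ u v))
      (cong₂ (λ i j → q * i + (q - + 2) * j)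
        (cong₂ _+_ (cong₂ (λ i j → - i + j)
          (trans (Σl-cong elems (λ γ → A0-entry γ s b c s' b' c')) (ΣF-select (c ⊹ c') (𝟙 (s ≟s s') * 𝟙 (b ≟ b'))))
          (trans (Σl-cong elems (λ γ → A1-entry γ s b c s' b' c')) (ΣF-select (b ⊹ b') (𝟙 (s ≟s s')))))
          (trans (Σl-cong elems (λ γ → A2-entry γ s b c s' b' c')) (ΣF-select (b ⊹ b') (𝟙 (L s s' ≟s yS)))))
        (trans (Σl-cong elems (λ γ → A3-entry γ s b c s' b' c')) (block-Σ-parameter (L s s') b c b' c')))))
      where
      linear : ∀ f₀ f₁ f₂ f₃ → Σl elems (λ γ → q * ((- f₀ γ + f₁ γ) + f₂ γ) + (q - + 2) * f₃ γ)
                               ≡ q * ((- Σl elems f₀ + Σl elems f₁) + Σl elems f₂) + (q - + 2) * Σl elems f₃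
      linear f₀ f₁ f₂ f₃ = begin
        Σl elems (λ γ → q * ((- f₀ γ + f₁ γ) + f₂ γ) + (q - + 2) * f₃ γ)
          ≡⟨ Σl-+ elems (λ γ → q * ((- f₀ γ + f₁ γ) + f₂ γ)) (λ γ → (q - + 2) * f₃ γ) ⟩
        Σl elems (λ γ → q * ((- f₀ γ + f₁ γ) + f₂ γ)) + Σl elems (λ γ → (q - + 2) * f₃ γ)
          ≡⟨ cong₂ _+_ (Σl-* elems q (λ γ → (- f₀ γ + f₁ γ) + f₂ γ)) (Σl-* elems (q - + 2) f₃) ⟩
        q * Σl elems (λ γ → (- f₀ γ + f₁ γ) + f₂ γ) + (q - + 2) * Σl elems f₃
          ≡⟨ cong (λ w → q * w + (q - + 2) * Σl elems f₃) (trans (Σl-+ elems (λ γ → - f₀ γ + f₁ γ) f₂)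
               (cong (_+ Σl elems f₂) (trans (Σl-+ elems (λ γ → - f₀ γ) f₁) (cong (_+ Σl elems f₁) (Σl-neg elems f₀))))) ⟩
        q * ((- Σl elems f₀ + Σl elems f₁) + Σl elems f₂) + (q - + 2) * Σl elems f₃ ∎
        where open ≡-Reasoning

    -- For s ≠ s' the two blocks never carry the same label, since L(s,t) = L(s',t) forces s = s'.
    blockProduct-offDiagonal : ¬ s ≡ s' → ∀ t → blockProduct (L s t) (L t s') ≡ inF (L s t) * inF (L s' t)
    blockProduct-offDiagonal s≢s' t rewrite symmetric t s' with L s t in e | L s' t in e'
    ... | el a | el a' with a ≟ a'
    ...   | yes refl = ⊥-elim (s≢s' (col-injective (trans e (sym e'))))
    ...   | no a≢a'  = blockProduct-distinct a a' a≢a'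
    blockProduct-offDiagonal s≢s' t | el a | xS = blockProduct-outsideʳ (el a) xS refl
    blockProduct-offDiagonal s≢s' t | el a | yS = blockProduct-outsideʳ (el a) yS refl
    blockProduct-offDiagonal s≢s' t | xS   | z' = blockProduct-outsideˡ xS z' refl
    blockProduct-offDiagonal s≢s' t | yS   | z' = blockProduct-outsideˡ yS z' refl

    offDiagonal-count : ¬ s ≡ s' → q - inF (L s' s) - inF (L s' (y-partner s)) ≡ rhs 0ℤ (𝟙 (L s s' ≟s yS)) (inF (L s s'))
    offDiagonal-count s≢s' rewrite symmetric s' s with L s s' in e
    ... | el a = trans (cong (λ i → q - 1ℤ - i) partner-in-F) (count q (𝟙 (b ≟ b')) (𝟙 (c ⊹ c' ≟ α ⊹ β)))
      where
      count : ∀ q i j → q - 1ℤ - 1ℤ ≡ q * q * ((0ℤ * i) * j) + (q * ((- (0ℤ * i) + 0ℤ) + 0ℤ) + (q - + 2) * 1ℤ)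
      count = solveℤ-∀
      partner-in-F : inF (L s' (y-partner s)) ≡ 1ℤ
      partner-in-F with L s' (y-partner s) in e''
      ... | el _ = refl
      ... | xS = ⊥-elim (el≢y (trans (sym e) (trans (cong (L s) (sym (L≡x⇒≡ e''))) (L-y-partner s))))
      ... | yS = ⊥-elim (s≢s' (sym (col-injective (trans e'' (sym (L-y-partner s))))))
    ... | xS = ⊥-elim (s≢s' (sym (L≡x⇒≡ e)))
    ... | yS = trans (cong (λ i → q - 0ℤ - inF i) (trans (cong (L s') (sym (y-partner-unique e))) (diagonal s')))
                     (count q (𝟙 (b ≟ b')) (𝟙 (c ⊹ c' ≟ α ⊹ β)))
      where
      count : ∀ q i j → q - 0ℤ - 0ℤ ≡ q * q * ((0ℤ * i) * j) + (q * ((- (0ℤ * i) + 0ℤ) + 1ℤ) + (q - + 2) * 0ℤ)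
      count = solveℤ-∀

    product-offDiagonal : ¬ s ≡ s' → (A3 α ∙ A3 β) u v ≡ A3²-rhs α β u v
    product-offDiagonal s≢s' = begin
      (A3 α ∙ A3 β) u v
        ≡⟨ product-entry ⟩
      Σl elemsS (λ t → blockProduct (L s t) (L t s'))
        ≡⟨ Σl-cong elemsS (blockProduct-offDiagonal s≢s') ⟩
      Σl elemsS (λ t → inF (L s t) * inF (L s' t))
        ≡⟨ Σ-row-inF s (inF ∘ L s') ⟩
      Σl elemsS (inF ∘ L s') - inF (L s' s) - inF (L s' (y-partner s))
        ≡⟨ cong (λ w → w - inF (L s' s) - inF (L s' (y-partner s))) (trans (row-reindex s' inF) ΣS-inF) ⟩
      q - inF (L s' s) - inF (L s' (y-partner s))
        ≡⟨ offDiagonal-count s≢s' ⟩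
      rhs 0ℤ (𝟙 (L s s' ≟s yS)) (inF (L s s'))
        ≡⟨ cong (λ i → rhs i (𝟙 (L s s' ≟s yS)) (inF (L s s'))) (sym (𝟙-no (s ≟s s') s≢s')) ⟩
      rhs (𝟙 (s ≟s s')) (𝟙 (L s s' ≟s yS)) (inF (L s s'))
        ≡⟨ sym RHS-entry ⟩
      A3²-rhs α β u v ∎
      where open ≡-Reasoning

    -- offset a a = (c + c') + (α + β) when b = b', and otherwise has exactly one zero a.
    Σ-blockProduct-same : Σl elems (λ a → blockProduct (el a) (el a))
                          ≡ q * q * (𝟙 (b ≟ b') * 𝟙 (c ⊹ c' ≟ α ⊹ β)) + q * (1ℤ - 𝟙 (b ≟ b'))
    Σ-blockProduct-same with b ≟ b'
    ... | yes refl = begin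
      Σl elems (λ a → blockProduct (el a) (el a))
        ≡⟨ Σl-cong elems (λ a → trans (blockProduct-same a) (cong (q *_) (𝟙-≟-by-sum _ _ _ _ (offset-diagonal a)))) ⟩
      Σl elems (λ _ → q * 𝟙 (c ⊹ c' ≟ α ⊹ β))
        ≡⟨ ΣF-const _ ⟩
      q * (q * 𝟙 (c ⊹ c' ≟ α ⊹ β))
        ≡⟨ regroup q (𝟙 (c ⊹ c' ≟ α ⊹ β)) ⟩
      q * q * (1ℤ * 𝟙 (c ⊹ c' ≟ α ⊹ β)) + q * (1ℤ - 1ℤ) ∎
      where
      open ≡-Reasoning
      rearrange : ∀ a b α β c c' → a ⊛ b ⊹ a ⊛ b ⊹ α ⊹ β ⊹ c ⊹ c' ≡ ((c ⊹ c') ⊹ (α ⊹ β)) ⊹ (a ⊛ b ⊹ a ⊛ b)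
      rearrange = solve-∀ 𝔽-ring
      offset-diagonal : ∀ a → 0F ⊹ offset a a ≡ (c ⊹ c') ⊹ (α ⊹ β)
      offset-diagonal a = trans (FR.+-identityˡ _) (trans (rearrange a b α β c c')
        (trans (cong ((c ⊹ c') ⊹ (α ⊹ β) ⊹_) (x⊹x≡0 (a ⊛ b))) (FR.+-identityʳ _)))
      regroup : ∀ q x → q * (q * x) ≡ q * q * (1ℤ * x) + q * (1ℤ - 1ℤ)
      regroup = solveℤ-∀
    ... | no b≢b' with linear-solution (b ⊹ b') (α ⊹ β ⊹ c ⊹ c') (b≢b' ∘ x⊹y≡0⇒x≡y)
    ...   | a₀ , unique , solves = begin
      Σl elems (λ a → blockProduct (el a) (el a))
        ≡⟨ Σl-cong elems blockProduct-same ⟩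
      Σl elems (λ a → q * 𝟙 (0F ≟ offset a a))
        ≡⟨ Σl-* elems q (λ a → 𝟙 (0F ≟ offset a a)) ⟩
      q * Σl elems (λ a → 𝟙 (0F ≟ offset a a))
        ≡⟨ cong (q *_) (ΣF-𝟙-unique (λ a → 0F ≟ offset a a) a₀
             (λ a 0≡offset → unique a (trans (FR.*-comm (b ⊹ b') a) (≡-by-sum (offset-linear a) 0≡offset)))
             (≡-by-sum (sym (offset-linear a₀)) (trans (FR.*-comm a₀ (b ⊹ b')) solves))) ⟩
      q * 1ℤ
        ≡⟨ regroup q (𝟙 (c ⊹ c' ≟ α ⊹ β)) ⟩
      q * q * (0ℤ * 𝟙 (c ⊹ c' ≟ α ⊹ β)) + q * (1ℤ - 0ℤ) ∎
      where
      open ≡-Reasoning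
      rearrange : ∀ a b b' α β c c' → a ⊛ b ⊹ a ⊛ b' ⊹ α ⊹ β ⊹ c ⊹ c' ≡ a ⊛ (b ⊹ b') ⊹ (α ⊹ β ⊹ c ⊹ c')
      rearrange = solve-∀ 𝔽-ring
      offset-linear : ∀ a → 0F ⊹ offset a a ≡ a ⊛ (b ⊹ b') ⊹ (α ⊹ β ⊹ c ⊹ c')
      offset-linear a = trans (FR.+-identityˡ _) (rearrange a b b' α β c c')
      regroup : ∀ q x → q * 1ℤ ≡ q * q * (0ℤ * x) + q * (1ℤ - 0ℤ)
      regroup = solveℤ-∀

    product-onDiagonal : s ≡ s' → (A3 α ∙ A3 β) u v ≡ A3²-rhs α β u v
    product-onDiagonal refl = begin
      (A3 α ∙ A3 β) u v
        ≡⟨ product-entry ⟩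
      Σl elemsS (λ t → blockProduct (L s t) (L t s))
        ≡⟨ Σl-cong elemsS (λ t → cong (blockProduct (L s t)) (symmetric t s)) ⟩
      Σl elemsS (λ t → blockProduct (L s t) (L s t))
        ≡⟨ row-reindex s (λ z → blockProduct z z) ⟩
      Σl elemsS (λ z → blockProduct z z)
        ≡⟨ ΣS-split (λ z → blockProduct z z) ⟩
      Σl elems (λ a → blockProduct (el a) (el a)) + (blockProduct xS xS + (blockProduct yS yS + 0ℤ))
        ≡⟨ cong₂ (λ i j → Σl elems (λ a → blockProduct (el a) (el a)) + (i + (j + 0ℤ)))
                 (blockProduct-outsideˡ xS xS refl) (blockProduct-outsideˡ yS yS refl) ⟩
      Σl elems (λ a → blockProduct (el a) (el a)) + (0ℤ + (0ℤ + 0ℤ))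
        ≡⟨ trans (ℤP.+-identityʳ _) Σ-blockProduct-same ⟩
      q * q * (𝟙 (b ≟ b') * 𝟙 (c ⊹ c' ≟ α ⊹ β)) + q * (1ℤ - 𝟙 (b ≟ b'))
        ≡⟨ regroup q (𝟙 (b ≟ b')) (𝟙 (c ⊹ c' ≟ α ⊹ β)) ⟩
      rhs 1ℤ 0ℤ 0ℤ
        ≡⟨ sym (cong₂ (λ i j → rhs i (𝟙 (j ≟s yS)) (inF j)) (𝟙-yes (s ≟s s) refl) (diagonal s)) ⟩
      rhs (𝟙 (s ≟s s)) (𝟙 (L s s ≟s yS)) (inF (L s s))
        ≡⟨ sym RHS-entry ⟩
      A3²-rhs α β u v ∎
      where
      open ≡-Reasoning
      regroup : ∀ q i x → q * q * (i * x) + q * (1ℤ - i)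
                ≡ q * q * ((1ℤ * i) * x) + (q * ((- (1ℤ * i) + 1ℤ) + 0ℤ) + (q - + 2) * 0ℤ)
      regroup = solveℤ-∀

  A3∙A3 : ∀ α β → (A3 α ∙ A3 β) ≋ A3²-rhs α β
  A3∙A3 α β (s , (b , c)) (s' , (b' , c')) = by-cases (s ≟s s')
    where
    open A3-square α β s b c s' b' c'
    by-cases : Dec (s ≡ s') → (A3 α ∙ A3 β) u v ≡ A3²-rhs α β u v
    by-cases (yes s≡s') = product-onDiagonal s≡s'
    by-cases (no s≢s')  = product-offDiagonal s≢s'

proposition3p5 :
  (m : ℕ) → 1 ≤ m → (𝔽 : FiniteField m) →
  (L : Sym (FiniteField.F 𝔽) → Sym (FiniteField.F 𝔽) → Sym (FiniteField.F 𝔽)) →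
  IsSymLatinDiagX L →
  let open FiniteField 𝔽
      open Construction 𝔽 L
  in (α β : F) →
    -- (i)
    ((A0 α ∙ A0 β) ≋ A0 (α + β)) × ((A0 α ∙ A3 β) ≋ A3 (α + β)) ×
    ((A0 α ∙ A1 β) ≋ A1 β) × ((A0 α ∙ A2 β) ≋ A2 β) ×
    -- (ii)
    ((A1 α ∙ A1 β) ≋ (q · A1 (α + β))) × ((A2 α ∙ A2 β) ≋ (q · A1 (α + β))) ×
    ((A1 α ∙ A2 β) ≋ (q · A2 (α + β))) ×
    -- (iii)
    ((A1 α ∙ A3 β) ≋ ΣF A3) × ((A2 α ∙ A3 β) ≋ ΣF A3) ×
    ((A3 α ∙ A3 β) ≋
      (((q *ℤ q) · A0 (α + β)) ⊕
       ΣF (λ γ → (q · ((⊖ A0 γ) ⊕ A1 γ ⊕ A2 γ)) ⊕ ((q -ℤ + 2) · A3 γ))))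
proposition3p5 m 1≤m 𝔽 L lat α β =
  A0∙A0 α β , A0∙A3 α β , A0∙A1 α β , A0∙A2 α β ,
  A1∙A1 α β , A2∙A2 α β , A1∙A2 α β ,
  A1∙A3 α β , A2∙A3 α β , A3∙A3 α β
  where open Products 1≤m 𝔽 L lat
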